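{- Let $n$ and $k$ be integers with $n > k > 2$ and $k > \lceil \frac{n}{2} \rceil$. Let $G_{k,2}$ be the bipartite graph whose two vertex classes are $\binom{[n]}{k}$ and $\binom{[n]}{2}$, where a $k$-element set $S$ and a $2$-element set $T$ are adjacent if and only if $T \subset S$. Then the domination number satisfies $\gamma(G_{k,2}) \leq \lceil \frac{n}{2} \rceil + 6$.
   Context: $[n] = \{1,2,\dots,n\}$, and $\binom{[n]}{m}$ denotes the family of all $m$-element subsets of $[n]$. For integers $n > k > l \geq 1$, $G_{k,l}$ denotes the bipartite graph with vertex classes $\binom{[n]}{k}$ and $\binom{[n]}{l}$, in which $S \in \binom{[n]}{k}$ and $T \in \binom{[n]}{l}$ are adjacent iff $T \subset S$; there are no other edges. A dominating set of a graph is a set $D$ of vertices such that every vertex not in $D$ has a neighbour in $D$; $\gamma(G)$ is the minimum size of a dominating set of $G$. -}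

module Defs where

open import Data.Nat using (ℕ; _≤_; _+_; _/_; suc)
open import Data.Fin.Subset using (Subset; ∣_∣; _⊂_)
open import Data.Sum using (_⊎_; inj₁; inj₂)
open import Data.Product using (Σ; ∃; _×_; _,_; proj₁)
open import Data.List using (List; length)
open import Data.List.Relation.Unary.Any using (Any)
open import Relation.Binary.PropositionalEquality using (_≡_)

⌈_/2⌉ : ℕ → ℕ
⌈ n /2⌉ = suc n / 2

Vertex : ℕ → ℕ → ℕ → Set
Vertex n k l = Σ (Subset n) (λ S → ∣ S ∣ ≡ k) ⊎ Σ (Subset n) (λ T → ∣ T ∣ ≡ l)

Adj : ∀ {n k l} → Vertex n k l → Vertex n k l → Set
Adj (inj₁ (S , _)) (inj₂ (T , _)) = T ⊂ S
Adj (inj₂ (T , _)) (inj₁ (S , _)) = T ⊂ S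
Adj (inj₁ _) (inj₁ _) = Data.Empty.⊥
  where import Data.Empty
Adj (inj₂ _) (inj₂ _) = Data.Empty.⊥
  where import Data.Empty

SameVertex : ∀ {n k l} → Vertex n k l → Vertex n k l → Set
SameVertex (inj₁ (S , _)) (inj₁ (S′ , _)) = S ≡ S′
SameVertex (inj₂ (T , _)) (inj₂ (T′ , _)) = T ≡ T′
SameVertex (inj₁ _) (inj₂ _) = Data.Empty.⊥
  where import Data.Empty
SameVertex (inj₂ _) (inj₁ _) = Data.Empty.⊥
  where import Data.Empty

Dominating : ∀ n k l → List (Vertex n k l) → Set
Dominating n k l D = (v : Vertex n k l) → Any (SameVertex v) D ⊎ Any (Adj v) D

γ≤ : ℕ → ℕ → ℕ → ℕ → Set
γ≤ n k l b = ∃ λ (D : List (Vertex n k l)) → Dominating n k l D × length D ≤ b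

-- The disjoint pairs {0,1}, {2,3}, … (there are ⌊n/2⌋ of them) dominate every k-set:
-- a set with more than ⌈n/2⌉ elements cannot avoid one element of each pair.
-- For the 2-sets, cut [n] into four intervals of length q = ⌈⌈n/2⌉/2⌉.  Any two of
-- them have together at most 2q ≤ ⌈n/2⌉ + 1 ≤ k elements, so each of the six unions
-- of two intervals extends to a k-set, and every 2-set lies in one of these six.
-- All inclusions are proper since 2 < k.
module Submission where

open import Defs
open import Data.Nat using (ℕ; _<_; _≤_; _+_)
open import Data.Nat.Base using (zero; suc; _*_; _/_; _%_; ⌊_/2⌋; z≤n; s≤s; s≤s⁻¹; NonZero)
import Data.Nat.Base as ℕ
open import Data.Nat.Properties
  using ( +-suc; +-comm; *-zeroʳ; suc-injective; n≤1+n; n≮0; ≤-trans; ≤-reflexive; ≤-antisym; <-≤-trans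
        ; <⇒≤; ≰⇒>; _≤?_; +-mono-≤; +-monoˡ-≤; +-monoʳ-<; ⌊n/2⌋≤⌈n/2⌉; module ≤-Reasoning)
open import Data.Nat.DivMod using (m/n≡1+[m∸n]/n; m/n*n≤m; m≡m%n+[m/n]*n; m%n<n; m<n*o⇒m/o<n)
open import Data.Fin using (Fin; zero; suc; toℕ; fromℕ<; _≟_)
open import Data.Fin.Properties using (toℕ<n; toℕ-fromℕ<; all?)
open import Data.Fin.Patterns using (0F; 1F; 2F; 3F)
open import Data.Fin.Subset using (Subset; ∣_∣; _⊆_; _⊂_; _∈_; _∪_; ⁅_⁆; inside; outside; ⊥; ⊤)
open import Data.Fin.Subset.Properties
  using ( ⊆-refl; drop-∷-⊆; out⊆; s⊆s; out⊂; out⊂in; in⊂in; ⊥⊆; ⊆⊤; ∣⊥∣≡0; ∣⊤∣≡n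
        ; x∈⁅y⁆⇒x≡y; x∈p∪q⁺; x∈p∪q⁻; p⊆p∪q; q⊆p∪q; x∈p⇒∣p-x∣<∣p∣)
open import Data.List using (List; []; _∷_; length; map; _++_)
open import Data.List.Properties using (length-map; length-++)
open import Data.List.Relation.Unary.Any using (Any; here; any?)
import Data.List.Relation.Unary.Any as Any
open import Data.List.Relation.Unary.Any.Properties using (map⁺; ++⁺ˡ; ++⁺ʳ)
open import Data.Vec using ([]; _∷_; here; there)
open import Data.Sum using (_⊎_; inj₁; inj₂)
open import Data.Product using (Σ; ∃; ∃₂; _×_; _,_; proj₁; proj₂)
open import Function using (_∘_)
open import Relation.Binary.PropositionalEquality using (_≡_; refl; sym; trans; cong; cong₂; subst; subst₂)
open import Relation.Nullary using (Dec; yes; no; contradiction)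
open import Data.Nat.Tactic.RingSolver using (solve-∀)
open import Relation.Nullary.Decidable using (toWitness; _⊎-dec_; _×-dec_)

SubsetOfSize : ℕ → ℕ → Set
SubsetOfSize n m = Σ (Subset n) λ p → ∣ p ∣ ≡ m

⌊n/2⌋≡n/2 : ∀ n → ⌊ n /2⌋ ≡ n / 2
⌊n/2⌋≡n/2 zero = refl
⌊n/2⌋≡n/2 (suc zero) = refl
⌊n/2⌋≡n/2 (suc (suc n)) =
  trans (cong suc (⌊n/2⌋≡n/2 n)) (sym (m/n≡1+[m∸n]/n {suc (suc n)} {2} (s≤s (s≤s z≤n))))

n≤⌈n/2⌉+⌈n/2⌉ : ∀ n → n ≤ ℕ.⌈ n /2⌉ + ℕ.⌈ n /2⌉
n≤⌈n/2⌉+⌈n/2⌉ zero = z≤n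
n≤⌈n/2⌉+⌈n/2⌉ (suc zero) = s≤s z≤n
n≤⌈n/2⌉+⌈n/2⌉ (suc (suc n)) =
  s≤s (subst (suc n ≤_) (sym (+-suc ℕ.⌈ n /2⌉ ℕ.⌈ n /2⌉)) (s≤s (n≤⌈n/2⌉+⌈n/2⌉ n)))

⌈n/2⌉+⌈n/2⌉≤1+n : ∀ n → ℕ.⌈ n /2⌉ + ℕ.⌈ n /2⌉ ≤ suc n
⌈n/2⌉+⌈n/2⌉≤1+n zero = z≤n
⌈n/2⌉+⌈n/2⌉≤1+n (suc zero) = s≤s (s≤s z≤n)
⌈n/2⌉+⌈n/2⌉≤1+n (suc (suc n)) =
  s≤s (subst (_≤ suc (suc n)) (sym (+-suc ℕ.⌈ n /2⌉ ℕ.⌈ n /2⌉)) (s≤s (⌈n/2⌉+⌈n/2⌉≤1+n n)))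

quotient-bounds : ∀ m q .{{_ : NonZero q}} → m / q * q ≤ m × m < m / q * q + q
quotient-bounds m q = m/n*n≤m m q , subst (_< m / q * q + q) (sym m≡[m/q]q+m%q) (+-monoʳ-< (m / q * q) (m%n<n m q))
  where
  m≡[m/q]q+m%q : m ≡ m / q * q + m % q
  m≡[m/q]q+m%q = trans (m≡m%n+[m/n]*n m q) (+-comm (m % q) (m / q * q))

∃-block : ∀ r q {m} → m < r * q → ∃ λ (a : Fin r) → toℕ a * q ≤ m × m < toℕ a * q + q
∃-block r zero {m} m<r*0 = contradiction (subst (m <_) (*-zeroʳ r) m<r*0) n≮0
∃-block r q@(suc _) {m} m<r*q =
  fromℕ< m/q<r , subst (λ a → a * q ≤ m × m < a * q + q) (sym (toℕ-fromℕ< m/q<r)) (quotient-bounds m q)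
  where
  m/q<r : m / q < r
  m/q<r = m<n*o⇒m/o<n m<r*q

p⊆q∧∣p∣<∣q∣⇒p⊂q : ∀ {n} {p q : Subset n} → p ⊆ q → ∣ p ∣ < ∣ q ∣ → p ⊂ q
p⊆q∧∣p∣<∣q∣⇒p⊂q {p = []} {[]} _ ()
p⊆q∧∣p∣<∣q∣⇒p⊂q {p = outside ∷ p} {inside ∷ q} p⊆q _ = out⊂in (drop-∷-⊆ p⊆q)
p⊆q∧∣p∣<∣q∣⇒p⊂q {p = outside ∷ p} {outside ∷ q} p⊆q lt = out⊂ (p⊆q∧∣p∣<∣q∣⇒p⊂q (drop-∷-⊆ p⊆q) lt)
p⊆q∧∣p∣<∣q∣⇒p⊂q {p = inside ∷ p} {outside ∷ q} p⊆q _ = contradiction (p⊆q here) λ ()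
p⊆q∧∣p∣<∣q∣⇒p⊂q {p = inside ∷ p} {inside ∷ q} p⊆q lt = in⊂in (p⊆q∧∣p∣<∣q∣⇒p⊂q (drop-∷-⊆ p⊆q) (s≤s⁻¹ lt))

∣p∪q∣≤∣p∣+∣q∣ : ∀ {n} (p q : Subset n) → ∣ p ∪ q ∣ ≤ ∣ p ∣ + ∣ q ∣
∣p∪q∣≤∣p∣+∣q∣ [] [] = z≤n
∣p∪q∣≤∣p∣+∣q∣ (inside ∷ p) (inside ∷ q) =
  s≤s (≤-trans (∣p∪q∣≤∣p∣+∣q∣ p q) (subst (∣ p ∣ + ∣ q ∣ ≤_) (sym (+-suc ∣ p ∣ ∣ q ∣)) (n≤1+n _)))
∣p∪q∣≤∣p∣+∣q∣ (inside ∷ p) (outside ∷ q) = s≤s (∣p∪q∣≤∣p∣+∣q∣ p q)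
∣p∪q∣≤∣p∣+∣q∣ (outside ∷ p) (inside ∷ q) =
  subst (∣ (outside ∷ p) ∪ (inside ∷ q) ∣ ≤_) (sym (+-suc ∣ p ∣ ∣ q ∣)) (s≤s (∣p∪q∣≤∣p∣+∣q∣ p q))
∣p∪q∣≤∣p∣+∣q∣ (outside ∷ p) (outside ∷ q) = ∣p∪q∣≤∣p∣+∣q∣ p q

superset-of-size : ∀ {n k} (p : Subset n) → ∣ p ∣ ≤ k → k ≤ n → Σ (Subset n) λ q → p ⊆ q × ∣ q ∣ ≡ k
superset-of-size [] z≤n z≤n = [] , ⊆-refl , refl
superset-of-size (inside ∷ p) (s≤s ∣p∣≤k) (s≤s k≤n) with superset-of-size p ∣p∣≤k k≤n
... | q , p⊆q , ∣q∣≡k = inside ∷ q , s⊆s p⊆q , cong suc ∣q∣≡k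
superset-of-size {suc n} {k} (outside ∷ p) ∣p∣≤k k≤1+n with k ≤? n
... | yes k≤n with superset-of-size p ∣p∣≤k k≤n
...   | q , p⊆q , ∣q∣≡k = outside ∷ q , s⊆s p⊆q , ∣q∣≡k
superset-of-size {suc n} {k} (outside ∷ p) ∣p∣≤k k≤1+n | no k≰n =
  inside ∷ ⊤ , out⊆ ⊆⊤ , trans (cong suc (∣⊤∣≡n n)) (≤-antisym (≰⇒> k≰n) k≤1+n)

∣p∣≡1⇒⊆⁅x⁆ : ∀ {n} {p : Subset n} → ∣ p ∣ ≡ 1 → ∃ λ x → p ⊆ ⁅ x ⁆
∣p∣≡1⇒⊆⁅x⁆ {p = outside ∷ p} ∣p∣≡1 with ∣p∣≡1⇒⊆⁅x⁆ ∣p∣≡1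
... | x , p⊆⁅x⁆ = suc x , out⊆ p⊆⁅x⁆
∣p∣≡1⇒⊆⁅x⁆ {p = inside ∷ p} ∣p∣≡1 = zero , s⊆s p⊆⊥
  where
  p⊆⊥ : p ⊆ ⊥
  p⊆⊥ x∈p = contradiction (<-≤-trans (x∈p⇒∣p-x∣<∣p∣ x∈p) (≤-reflexive (suc-injective ∣p∣≡1))) n≮0

∣p∣≡2⇒⊆⁅x⁆∪⁅y⁆ : ∀ {n} {p : Subset n} → ∣ p ∣ ≡ 2 → ∃₂ λ x y → p ⊆ ⁅ x ⁆ ∪ ⁅ y ⁆
∣p∣≡2⇒⊆⁅x⁆∪⁅y⁆ {p = outside ∷ p} ∣p∣≡2 with ∣p∣≡2⇒⊆⁅x⁆∪⁅y⁆ ∣p∣≡2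
... | x , y , p⊆ = suc x , suc y , out⊆ p⊆
∣p∣≡2⇒⊆⁅x⁆∪⁅y⁆ {p = inside ∷ p} ∣p∣≡2 with ∣p∣≡1⇒⊆⁅x⁆ (suc-injective ∣p∣≡2)
... | y , p⊆⁅y⁆ = zero , suc y , s⊆s (x∈p∪q⁺ ∘ inj₂ ∘ p⊆⁅y⁆)

shift₂ : ∀ {n m} → SubsetOfSize n m → SubsetOfSize (suc (suc n)) m
shift₂ (p , ∣p∣≡m) = outside ∷ outside ∷ p , ∣p∣≡m

consecutivePairs : ∀ n → List (SubsetOfSize n 2)
consecutivePairs zero = []
consecutivePairs (suc zero) = []
consecutivePairs (suc (suc n)) =
  (inside ∷ inside ∷ ⊥ , cong (2 +_) (∣⊥∣≡0 n)) ∷ map shift₂ (consecutivePairs n)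

length-consecutivePairs : ∀ n → length (consecutivePairs n) ≡ ⌊ n /2⌋
length-consecutivePairs zero = refl
length-consecutivePairs (suc zero) = refl
length-consecutivePairs (suc (suc n)) = cong suc (trans (length-map _ (consecutivePairs n)) (length-consecutivePairs n))

shifted-⊆ : ∀ {n x y} {p : Subset n} → Any (λ T → proj₁ T ⊆ p) (consecutivePairs n) →
            Any (λ T → proj₁ T ⊆ x ∷ y ∷ p) (consecutivePairs (suc (suc n)))
shifted-⊆ {x = x} {y} {p} = Any.there ∘ map⁺ {f = shift₂} ∘ Any.map out⊆²
  where
  out⊆² : ∀ {q : Subset _} → q ⊆ p → outside ∷ outside ∷ q ⊆ x ∷ y ∷ p
  out⊆² q⊆p = out⊆ (out⊆ q⊆p)

consecutivePair-⊆ : ∀ n (p : Subset n) → ℕ.⌈ n /2⌉ < ∣ p ∣ → Any (λ T → proj₁ T ⊆ p) (consecutivePairs n)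
consecutivePair-⊆ zero [] ()
consecutivePair-⊆ (suc zero) (inside ∷ []) (s≤s ())
consecutivePair-⊆ (suc zero) (outside ∷ []) ()
consecutivePair-⊆ (suc (suc n)) (inside ∷ inside ∷ p) _ = here (s⊆s (s⊆s ⊥⊆))
consecutivePair-⊆ (suc (suc n)) (inside ∷ outside ∷ p) lt = shifted-⊆ (consecutivePair-⊆ n p (s≤s⁻¹ lt))
consecutivePair-⊆ (suc (suc n)) (outside ∷ inside ∷ p) lt = shifted-⊆ (consecutivePair-⊆ n p (s≤s⁻¹ lt))
consecutivePair-⊆ (suc (suc n)) (outside ∷ outside ∷ p) lt =
  shifted-⊆ (consecutivePair-⊆ n p (≤-trans (n≤1+n _) lt))

consecutivePairs-meet : ∀ {n k} → ℕ.⌈ n /2⌉ < k →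
  ∀ (S : SubsetOfSize n k) → Any (λ T → proj₁ T ⊆ proj₁ S) (consecutivePairs n)
consecutivePairs-meet {n} h<k (S , ∣S∣≡k) = consecutivePair-⊆ n S (subst (ℕ.⌈ n /2⌉ <_) (sym ∣S∣≡k) h<k)

block : ℕ → ℕ → (n : ℕ) → Subset n
block lo len zero = []
block (suc lo) len (suc n) = outside ∷ block lo len n
block zero zero (suc n) = ⊥
block zero (suc len) (suc n) = inside ∷ block zero len n

∣block∣≤len : ∀ lo len n → ∣ block lo len n ∣ ≤ len
∣block∣≤len lo len zero = z≤n
∣block∣≤len (suc lo) len (suc n) = ∣block∣≤len lo len n
∣block∣≤len zero zero (suc n) = ≤-reflexive (∣⊥∣≡0 (suc n))
∣block∣≤len zero (suc len) (suc n) = s≤s (∣block∣≤len zero len n)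

∈-block : ∀ {lo len n} {i : Fin n} → lo ≤ toℕ i → toℕ i < lo + len → i ∈ block lo len n
∈-block {suc lo} {i = suc i} (s≤s lo≤i) (s≤s i<lo+len) = there (∈-block lo≤i i<lo+len)
∈-block {zero} {zero} _ ()
∈-block {zero} {suc len} {i = zero} _ _ = here
∈-block {zero} {suc len} {i = suc i} _ (s≤s i<len) = there (∈-block z≤n i<len)

module QuarterCover {n k q : ℕ} (n≤4q : n ≤ 4 * q) (q+q≤k : q + q ≤ k) (k≤n : k ≤ n) where

  quarter : Fin 4 → Subset n
  quarter a = block (toℕ a * q) q n

  ∃-quarter : ∀ i → ∃ λ a → i ∈ quarter a
  ∃-quarter i with ∃-block 4 q (<-≤-trans (toℕ<n i) n≤4q)
  ... | a , lower , upper = a , ∈-block lower upper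

  superset-of-quarters : (c d : Fin 4) → Σ (Subset n) λ S → quarter c ∪ quarter d ⊆ S × ∣ S ∣ ≡ k
  superset-of-quarters c d = superset-of-size (quarter c ∪ quarter d) ∣quarter∪quarter∣≤k k≤n
    where
    ∣quarter∪quarter∣≤k : ∣ quarter c ∪ quarter d ∣ ≤ k
    ∣quarter∪quarter∣≤k = ≤-trans (∣p∪q∣≤∣p∣+∣q∣ (quarter c) (quarter d))
      (≤-trans (+-mono-≤ (∣block∣≤len _ q n) (∣block∣≤len _ q n)) q+q≤k)

  span : Fin 4 × Fin 4 → SubsetOfSize n k
  span (c , d) = proj₁ (superset-of-quarters c d) , proj₂ (proj₂ (superset-of-quarters c d))

  quarter⊆span : ∀ {a c d} → a ≡ c ⊎ a ≡ d → quarter a ⊆ proj₁ (span (c , d))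
  quarter⊆span {c = c} {d} (inj₁ refl) = proj₁ (proj₂ (superset-of-quarters c d)) ∘ p⊆p∪q (quarter d)
  quarter⊆span {c = c} {d} (inj₂ refl) = proj₁ (proj₂ (superset-of-quarters c d)) ∘ q⊆p∪q (quarter c) (quarter d)

  quarterPairs : List (Fin 4 × Fin 4)
  quarterPairs = (0F , 1F) ∷ (0F , 2F) ∷ (0F , 3F) ∷ (1F , 2F) ∷ (1F , 3F) ∷ (2F , 3F) ∷ []

  Covers : Fin 4 → Fin 4 → Fin 4 × Fin 4 → Set
  Covers a b (c , d) = (a ≡ c ⊎ a ≡ d) × (b ≡ c ⊎ b ≡ d)

  quarterPairs-cover : ∀ a b → Any (Covers a b) quarterPairs
  quarterPairs-cover = toWitness {a? = all? λ a → all? λ b → any? (covers? a b) quarterPairs} _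
    where
    covers? : ∀ a b cd → Dec (Covers a b cd)
    covers? a b (c , d) = ((a ≟ c) ⊎-dec (a ≟ d)) ×-dec ((b ≟ c) ⊎-dec (b ≟ d))

  spans : List (SubsetOfSize n k)
  spans = map span quarterPairs

  spans-cover : ∀ (T : SubsetOfSize n 2) → Any (λ S → proj₁ T ⊆ proj₁ S) spans
  spans-cover (T , ∣T∣≡2) with ∣p∣≡2⇒⊆⁅x⁆∪⁅y⁆ ∣T∣≡2
  ... | i , j , T⊆⁅i⁆∪⁅j⁆ with ∃-quarter i | ∃-quarter j
  ...   | a , i∈a | b , j∈b = map⁺ {f = span} (Any.map T⊆span (quarterPairs-cover a b))
    where
    T⊆span : ∀ {cd} → Covers a b cd → T ⊆ proj₁ (span cd)
    T⊆span {c , d} (a∈cd , b∈cd) x∈T with x∈p∪q⁻ ⁅ i ⁆ ⁅ j ⁆ (T⊆⁅i⁆∪⁅j⁆ x∈T)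
    ... | inj₁ x∈⁅i⁆ = quarter⊆span a∈cd (subst (_∈ quarter a) (sym (x∈⁅y⁆⇒x≡y i x∈⁅i⁆)) i∈a)
    ... | inj₂ x∈⁅j⁆ = quarter⊆span b∈cd (subst (_∈ quarter b) (sym (x∈⁅y⁆⇒x≡y j x∈⁅j⁆)) j∈b)

vertices : ∀ {n k l} → List (SubsetOfSize n l) → List (SubsetOfSize n k) → List (Vertex n k l)
vertices L K = map inj₂ L ++ map inj₁ K

length-vertices : ∀ {n k l} (L : List (SubsetOfSize n l)) (K : List (SubsetOfSize n k)) →
                  length (vertices L K) ≡ length L + length K
length-vertices L K = trans (length-++ (map inj₂ L))
  (cong₂ _+_ (length-map inj₂ L) (length-map inj₁ K))

vertices-dominating : ∀ {n k l} (L : List (SubsetOfSize n l)) (K : List (SubsetOfSize n k)) → l < k →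
  (∀ (S : SubsetOfSize n k) → Any (λ T → proj₁ T ⊆ proj₁ S) L) →
  (∀ (T : SubsetOfSize n l) → Any (λ S → proj₁ T ⊆ proj₁ S) K) →
  Dominating n k l (vertices L K)
vertices-dominating {n} {k} {l} L K l<k L-meets K-covers = dominated
  where
  ⊆⇒⊂ : (T : SubsetOfSize n l) (S : SubsetOfSize n k) → proj₁ T ⊆ proj₁ S → proj₁ T ⊂ proj₁ S
  ⊆⇒⊂ (T , ∣T∣≡l) (S , ∣S∣≡k) T⊆S = p⊆q∧∣p∣<∣q∣⇒p⊂q T⊆S (subst₂ _<_ (sym ∣T∣≡l) (sym ∣S∣≡k) l<k)

  dominated : Dominating n k l (vertices L K)
  dominated (inj₁ S) = inj₂ (++⁺ˡ (map⁺ (Any.map (λ {T} → ⊆⇒⊂ T S) (L-meets S))))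
  dominated (inj₂ T) = inj₂ (++⁺ʳ (map inj₂ L) (map⁺ (Any.map (λ {S} → ⊆⇒⊂ T S) (K-covers T))))

[m+m]+[m+m]≡4*m : ∀ m → (m + m) + (m + m) ≡ 4 * m
[m+m]+[m+m]≡4*m = solve-∀

n≤4⌈⌈n/2⌉/2⌉ : ∀ n → n ≤ 4 * ℕ.⌈ ℕ.⌈ n /2⌉ /2⌉
n≤4⌈⌈n/2⌉/2⌉ n = begin
  n                 ≤⟨ n≤⌈n/2⌉+⌈n/2⌉ n ⟩
  h + h             ≤⟨ +-mono-≤ (n≤⌈n/2⌉+⌈n/2⌉ h) (n≤⌈n/2⌉+⌈n/2⌉ h) ⟩
  (q + q) + (q + q) ≡⟨ [m+m]+[m+m]≡4*m q ⟩
  4 * q             ∎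
  where
  open ≤-Reasoning
  h = ℕ.⌈ n /2⌉
  q = ℕ.⌈ h /2⌉

theorem1 : (n k : ℕ) → k < n → 2 < k → ⌈ n /2⌉ < k →
    γ≤ n k 2 (⌈ n /2⌉ + 6)
theorem1 n k k<n 2<k ⌈n/2⌉<k =
  vertices (consecutivePairs n) spans ,
  vertices-dominating (consecutivePairs n) spans 2<k (consecutivePairs-meet h<k) spans-cover ,
  size-bound
  where
  ⌈n/2⌉-agrees : ⌈ n /2⌉ ≡ ℕ.⌈ n /2⌉
  ⌈n/2⌉-agrees = sym (⌊n/2⌋≡n/2 (suc n))

  h<k : ℕ.⌈ n /2⌉ < k
  h<k = subst (_< k) ⌈n/2⌉-agrees ⌈n/2⌉<k

  open QuarterCover {q = ℕ.⌈ ℕ.⌈ n /2⌉ /2⌉} (n≤4⌈⌈n/2⌉/2⌉ n) (≤-trans (⌈n/2⌉+⌈n/2⌉≤1+n ℕ.⌈ n /2⌉) h<k) (<⇒≤ k<n)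

  size-bound : length (vertices (consecutivePairs n) spans) ≤ ⌈ n /2⌉ + 6
  size-bound = begin
    length (vertices (consecutivePairs n) spans) ≡⟨ length-vertices (consecutivePairs n) spans ⟩
    length (consecutivePairs n) + 6              ≡⟨ cong (_+ 6) (length-consecutivePairs n) ⟩
    ⌊ n /2⌋ + 6                                  ≤⟨ +-monoˡ-≤ 6 (⌊n/2⌋≤⌈n/2⌉ n) ⟩
    ℕ.⌈ n /2⌉ + 6                                ≡⟨ cong (_+ 6) ⌈n/2⌉-agrees ⟨
    ⌈ n /2⌉ + 6                                  ∎
    where open ≤-Reasoning
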